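{- Let a board (a finite set $L$ of locations, every one of which initially holds a piece) be given, together with a valid solution: a finite sequence of moves, each valid at the time it is executed and each belonging to the piece type of the moving piece, after which exactly one piece remains. Let $r$ be the location of this final piece. Then: (1) for every location $v \neq r$, there is exactly one move in the solution whose first location is $v$ (a "move out of $v$"); (2) for any location $v_0$, the sequence $v_0, v_1, v_2, \dots$ obtained by letting $v_{i+1}$ be the last location of the unique move out of $v_i$ (for as long as $v_i \ne r$) is finite and terminates at $r$.
   Context: Generalized model: a board is a finite set $L$ of locations together with a set of pieces, each assigned a distinct location. A move is a finite sequence $\langle \ell_0, \ell_1, \dots, \ell_k\rangle$ of locations with $k\ge 1$; it is valid (in the current board) if $\ell_0$ and $\ell_k$ each hold a piece while $\ell_1,\dots,\ell_{k-1}$ are empty. Executing a valid move removes the piece at $\ell_k$ and moves the piece at $\ell_0$ to $\ell_k$. A piece type is a set of moves; a piece of type $T$ may execute only moves in $T$. Standing assumption: every location of the board is initially occupied. -}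

module Defs where

open import Level using (0ℓ)
open import Data.Nat using (ℕ)
open import Data.Fin using (Fin; _≟_)
open import Data.Maybe using (Maybe; just; nothing; Is-just)
open import Data.List using (List; []; _∷_; length; lookup)
open import Data.List.Relation.Unary.All using (All)
open import Data.Product using (Σ; ∃; _×_; _,_)
open import Relation.Nullary using (¬_; yes; no)
open import Relation.Unary using (Pred)
open import Relation.Binary.PropositionalEquality using (_≡_; _≢_)

-- Locations of a board with n locations: Fin n.
-- A move ⟨ℓ₀, ℓ₁, …, ℓₖ⟩ with k ≥ 1: first location, the list of
-- intermediate locations ℓ₁ … ℓₖ₋₁, and the last location ℓₖ.
record Move (n : ℕ) : Set where
  constructor mkMove
  field
    first  : Fin n
    middle : List (Fin n)
    last   : Fin n
open Move public

PieceType : ℕ → Set₁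
PieceType n = Pred (Move n) 0ℓ

-- Since every location is initially occupied, pieces are identified with
-- their initial location.  A board state records, for each location, the
-- piece (if any) occupying it.
Piece : ℕ → Set
Piece n = Fin n

State : ℕ → Set
State n = Fin n → Maybe (Piece n)

initial : ∀ {n} → State n
initial ℓ = just ℓ

Empty : ∀ {n} → State n → Fin n → Set
Empty s ℓ = s ℓ ≡ nothing

-- The captured piece (at the
-- last location) is a different piece, so first ≢ last.
ValidMove : ∀ {n} → (Piece n → PieceType n) → State n → Move n → Set
ValidMove {n} ty s m =
  Σ (Piece n) λ p → (s (first m) ≡ just p) × ty p m
    × Is-just (s (last m)) × All (Empty s) (middle m) × (first m ≢ last m)

execute : ∀ {n} → State n → Move n → State n
execute s m ℓ with ℓ ≟ last m
... | yes _ = s (first m)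
... | no _ with ℓ ≟ first m
...   | yes _ = nothing
...   | no _  = s ℓ

data Runs {n} (ty : Piece n → PieceType n) : State n → List (Move n) → State n → Set where
  done : ∀ {s} → Runs ty s [] s
  step : ∀ {s m ms s'} → ValidMove ty s m → Runs ty (execute s m) ms s' →
         Runs ty s (m ∷ ms) s'

OnlyPieceAt : ∀ {n} → State n → Fin n → Set
OnlyPieceAt s r = Is-just (s r) × (∀ ℓ → ℓ ≢ r → s ℓ ≡ nothing)

ExactlyOneMoveOutOf : ∀ {n} → List (Move n) → Fin n → Set
ExactlyOneMoveOutOf ms v =
  Σ (Fin (length ms)) λ i → (first (lookup ms i) ≡ v)
    × (∀ j → first (lookup ms j) ≡ v → j ≡ i)

data ChainReaches {n} (ms : List (Move n)) (r : Fin n) : Fin n → Set where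
  atRoot : ChainReaches ms r r
  follow : ∀ {v} (i : Fin (length ms)) → v ≢ r → first (lookup ms i) ≡ v →
           ChainReaches ms r (last (lookup ms i)) → ChainReaches ms r v

module Submission where

-- A location that is empty stays empty: a move only lands on an occupied
-- location and only vacates its own first location.  Hence every location
-- other than r, occupied at the start and empty at the end, is left by a
-- move, and by exactly one, since it is empty from then on.  The same
-- observation shows that a move out of the landing square of move i comes
-- strictly after i, so following the moves out of v₀ visits moves of
-- strictly increasing index and must stop, which happens only at r.

open import Defs
open import Data.Nat using (ℕ; z≤n; s≤s)
open import Data.Fin using (Fin; zero; suc; _≟_; _<_; _>_)
open import Data.Fin.Induction using (>-wellFounded)
open import Data.List using (List; length; lookup)
open import Data.Maybe using (Maybe; nothing; Is-just)
open import Data.Maybe.Relation.Unary.Any using (just)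
open import Data.Product using (Σ-syntax; _×_; _,_; proj₁; proj₂)
open import Data.Unit using (tt)
open import Data.Empty using (⊥-elim)
open import Induction.WellFounded using (Acc; acc)
open import Relation.Nullary using (yes; no)
open import Relation.Binary.PropositionalEquality
  using (_≡_; _≢_; refl; sym; trans; cong; subst)

Is-just⇒≢nothing : ∀ {A : Set} {x : Maybe A} → Is-just x → x ≢ nothing
Is-just⇒≢nothing (just _) ()

module _ {n : ℕ} where

  execute-vacates-first : ∀ (s : State n) m → first m ≢ last m →
                          Empty (execute s m) (first m)
  execute-vacates-first s m first≢last with first m ≟ last m
  ... | yes first≡last = ⊥-elim (first≢last first≡last)
  ... | no _ with first m ≟ first m
  ...   | yes _ = refl
  ...   | no first≢first = ⊥-elim (first≢first refl)

  execute-preserves-Empty : ∀ (s : State n) m {v} → Is-just (s (last m)) →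
                            Empty s v → Empty (execute s m) v
  execute-preserves-Empty s m {v} last-occupied v-empty with v ≟ last m
  ... | yes refl = ⊥-elim (Is-just⇒≢nothing last-occupied v-empty)
  ... | no _ with v ≟ first m
  ...   | yes _ = refl
  ...   | no _  = v-empty

  execute-preserves-occupied : ∀ (s : State n) m {v} → Is-just (s (first m)) →
                               v ≢ first m → Is-just (s v) → Is-just (execute s m v)
  execute-preserves-occupied s m {v} first-occupied v≢first v-occupied with v ≟ last m
  ... | yes _ = first-occupied
  ... | no _ with v ≟ first m
  ...   | yes v≡first = ⊥-elim (v≢first v≡first)
  ...   | no _ = v-occupied

  module _ (ms : List (Move n)) (r : Fin n)
           (moveOutOf : ∀ v → v ≢ r → Σ[ i ∈ Fin (length ms) ] first (lookup ms i) ≡ v)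
           (landing<departure : ∀ i j → last (lookup ms i) ≡ first (lookup ms j) → i < j)
           where

    private
      continue : ∀ v → (∀ i → first (lookup ms i) ≡ v → ChainReaches ms r (last (lookup ms i))) →
                 ChainReaches ms r v
      continue v fromMove with v ≟ r
      ... | yes refl = atRoot
      ... | no v≢r with i , i-out ← moveOutOf v v≢r = follow i v≢r i-out (fromMove i i-out)

      chainReaches-last : ∀ i → Acc _>_ i → ChainReaches ms r (last (lookup ms i))
      chainReaches-last i (acc later) = continue _ λ j j-out →
        chainReaches-last j (later (landing<departure i j (sym j-out)))

    chainReaches : ∀ v → ChainReaches ms r v
    chainReaches v = continue v λ i _ → chainReaches-last i (>-wellFounded i)

module _ {n : ℕ} {ty : Piece n → PieceType n} where

  ValidMove⇒first-occupied : ∀ {s m} → ValidMove ty s m → Is-just (s (first m))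
  ValidMove⇒first-occupied (_ , first-at-p , _) = subst Is-just (sym first-at-p) (just tt)

  Empty⇒untouched : ∀ {s ms s' v} → Runs ty s ms s' → Empty s v → ∀ i →
                    first (lookup ms i) ≢ v × last (lookup ms i) ≢ v
  Empty⇒untouched (step valid@(_ , _ , _ , last-occupied , _) _) v-empty zero =
    (λ { refl → Is-just⇒≢nothing (ValidMove⇒first-occupied valid) v-empty }) ,
    (λ { refl → Is-just⇒≢nothing last-occupied v-empty })
  Empty⇒untouched {s} (step {m = m} (_ , _ , _ , last-occupied , _ , _) run) v-empty (suc i) =
    Empty⇒untouched run (execute-preserves-Empty s m last-occupied v-empty) i

  vacated⇒moveOutOf : ∀ {s ms s' v} → Runs ty s ms s' → Is-just (s v) → Empty s' v →
                      Σ[ i ∈ Fin (length ms) ] first (lookup ms i) ≡ v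
  vacated⇒moveOutOf done v-occupied v-empty = ⊥-elim (Is-just⇒≢nothing v-occupied v-empty)
  vacated⇒moveOutOf {s} {v = v} (step {m = m} valid run) v-occupied v-empty with v ≟ first m
  ... | yes v≡first = zero , sym v≡first
  ... | no v≢first
    with i , i-out ← vacated⇒moveOutOf run
           (execute-preserves-occupied s m (ValidMove⇒first-occupied valid) v≢first v-occupied)
           v-empty
    = suc i , i-out

  moveOutOf-unique : ∀ {s ms s'} → Runs ty s ms s' → ∀ i j →
                     first (lookup ms i) ≡ first (lookup ms j) → i ≡ j
  moveOutOf-unique (step _ _) zero zero _ = refl
  moveOutOf-unique {s} (step {m = m} (_ , _ , _ , _ , _ , first≢last) run) zero (suc j) same =
    ⊥-elim (proj₁ (Empty⇒untouched run (execute-vacates-first s m first≢last) j) (sym same))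
  moveOutOf-unique {s} (step {m = m} (_ , _ , _ , _ , _ , first≢last) run) (suc i) zero same =
    ⊥-elim (proj₁ (Empty⇒untouched run (execute-vacates-first s m first≢last) i) same)
  moveOutOf-unique (step _ run) (suc i) (suc j) same = cong suc (moveOutOf-unique run i j same)

  landing<departure : ∀ {s ms s'} → Runs ty s ms s' → ∀ i j →
                      last (lookup ms i) ≡ first (lookup ms j) → i < j
  landing<departure (step (_ , _ , _ , _ , _ , first≢last) _) zero zero same = ⊥-elim (first≢last (sym same))
  landing<departure (step _ _) zero (suc j) _ = s≤s z≤n
  landing<departure {s} (step {m = m} (_ , _ , _ , _ , _ , first≢last) run) (suc i) zero same =
    ⊥-elim (proj₂ (Empty⇒untouched run (execute-vacates-first s m first≢last) i) same)
  landing<departure (step _ run) (suc i) (suc j) same = s≤s (landing<departure run i j same)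

lemma1 : ∀ (n : ℕ) (ty : Piece n → PieceType n) (sol : List (Move n))
           (final : State n) (r : Fin n) →
           Runs ty initial sol final → OnlyPieceAt final r →
           (∀ v → v ≢ r → ExactlyOneMoveOutOf sol v)
           × (∀ v₀ → ChainReaches sol r v₀)
lemma1 n ty sol final r run (_ , only-r) =
  exactlyOne , chainReaches sol r moveOutOf (landing<departure run)
  where
  moveOutOf : ∀ v → v ≢ r → Σ[ i ∈ Fin (length sol) ] first (lookup sol i) ≡ v
  moveOutOf v v≢r = vacated⇒moveOutOf run (just tt) (only-r v v≢r)

  exactlyOne : ∀ v → v ≢ r → ExactlyOneMoveOutOf sol v
  exactlyOne v v≢r with i , i-out ← moveOutOf v v≢r =
    i , i-out , λ j j-out → moveOutOf-unique run j i (trans j-out (sym i-out))
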